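{- Let $G=P_{\infty}\boxtimes P_{\infty}$ be the infinite strong grid (king graph): its vertex set is $\mathbb{Z}^2$ and two distinct vertices $(i_1,j_1),(i_2,j_2)$ are adjacent if and only if $\max\{|i_1-i_2|,|j_1-j_2|\}=1$. Let $L=\{a(2,1)+b(-1,3): a,b\in\mathbb{Z}\}$ and $L'=\{a(1,3)+b(2,-1): a,b\in\mathbb{Z}\}$ (both are sublattices of $\mathbb{Z}^2$ of index $7$). Call a set of vertices a $D$-configuration if it is a translate $x+L$ ($x\in\mathbb{Z}^2$), and a $D'$-configuration if it is a translate $x+L'$. Then, with guards initially placed on a $D$-configuration (one guard per vertex), the guards can eternally dominate $G$ in the all-guards-move model: for every guard configuration that is a $D$-configuration (respectively a $D'$-configuration) and every attacked vertex $v\in\mathbb{Z}^2$, the guards can respond by a simultaneous move in which every guard stays in place or moves to an adjacent vertex, no two guards end on the same vertex, and the resulting set of occupied vertices is a $D'$-configuration (respectively a $D$-configuration) containing $v$. Consequently, the guards (alternating between $D$- and $D'$-configurations) defend against every infinite sequence of attacks.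
   Context: Eternal domination game, all-guards-move model: guards occupy distinct vertices of a graph. At each turn an attacker chooses a vertex; the guards then respond by moving any number of guards simultaneously, each guard either staying where it is or moving to an adjacent vertex, with at most one guard per vertex afterwards, and the attacked vertex must then be occupied by a guard. The guards defend the graph if they can respond successfully to every infinite sequence of attacks. -}

module Defs where

open import Data.Integer using (ℤ; +_; -[1+_]; _+_; _-_; _*_; -_; ∣_∣)
open import Data.Nat using (ℕ; _⊔_)
open import Data.Product using (Σ; ∃; ∃-syntax; _×_; _,_; proj₁)
open import Data.Sum using (_⊎_)
open import Relation.Binary.PropositionalEquality using (_≡_)
open import Function.Bundles using (_⇔_)

V : Set
V = ℤ × ℤ

Adj : V → V → Set
Adj (i₁ , j₁) (i₂ , j₂) = (∣ i₁ - i₂ ∣ ⊔ ∣ j₁ - j₂ ∣) ≡ 1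

VSet : Set₁
VSet = V → Set

D : V → VSet
D (x₁ , x₂) (p₁ , p₂) =
  ∃[ a ] ∃[ b ] (p₁ ≡ x₁ + (a * + 2 + b * - + 1)) × (p₂ ≡ x₂ + (a * + 1 + b * + 3))

D' : V → VSet
D' (x₁ , x₂) (p₁ , p₂) =
  ∃[ a ] ∃[ b ] (p₁ ≡ x₁ + (a * + 1 + b * + 2)) × (p₂ ≡ x₂ + (a * + 3 + b * - + 1))

record Move (S T : VSet) : Set where
  field
    move      : Σ V S → V
    local     : ∀ g → move g ≡ proj₁ g ⊎ Adj (proj₁ g) (move g)
    injective : ∀ g h → move g ≡ move h → proj₁ g ≡ proj₁ h
    onto      : ∀ q → T q ⇔ (∃[ g ] move g ≡ q)

-- L = {(i , j) : i ≡ 2j (mod 7)} and L' = {(i , j) : i ≡ -2j (mod 7)}. Fix a base point c and let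
-- the guard on a vertex whose row j has residue s = j - c₂ mod 7 make a king move depending only on s:
-- row 0 stays, and the rows of residues 1↔2, 3↔4, 5↔6 trade places by one vertical step, each
-- combined with a horizontal step chosen so that i - 2j ≡ 0 turns into i + 2j ≡ 0. This is a
-- permutation of ℤ² moving every vertex by at most one and carrying c + L exactly onto c + L', so
-- it and its inverse are legal moves between these two configurations. Any D-configuration x + L
-- equals c + L for every c ∈ x + L, and since L + L' = ℤ², c can be chosen with v ∈ c + L'.

module Submission where

open import Data.Empty using (⊥-elim)
open import Data.Fin using (Fin; toℕ; fromℕ<)
import Data.Fin as Fin
open import Data.Fin.Patterns using (0F; 1F; 2F; 3F; 4F; 5F; 6F)
open import Data.Fin.Properties using (all?; toℕ-fromℕ<; toℕ-injective; toℕ<n)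
open import Data.Integer using (ℤ; +_; -[1+_]; +[1+_]; _+_; _-_; _*_; -_)
import Data.Integer as ℤ
open import Data.Integer.DivMod using (_/ℕ_; n%ℕd<d; a≡a%ℕn+[a/ℕn]*n)
open import Data.Integer.Properties
  using (+-injective; pos-*; ∣i-j∣≡∣j-i∣; *-zeroʳ; +-identityʳ; neg-distribʳ-*; +-inverseʳ)
open import Data.Integer.Tactic.RingSolver using (solve)
open import Data.List using (_∷_; [])
open import Data.Nat using (ℕ; suc; NonZero; ⌈_/2⌉)
import Data.Nat as ℕ
import Data.Nat.Properties as ℕ
open import Data.Product using (∃-syntax; _×_; _,_; proj₁; proj₂)
open import Data.Product.Properties using (≡-dec)
open import Data.Sum using (_⊎_; inj₁; inj₂)
import Data.Sum as Sum
open import Function.Bundles using (_⇔_; mk⇔; Equivalence; _↔_; mk↔ₛ′; Inverse)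
import Function.Properties.Equivalence as ⇔
open import Function.Properties.Inverse using (↔-sym)
open import Relation.Binary.PropositionalEquality
  using (_≡_; _≢_; refl; sym; trans; cong; cong₂; subst; module ≡-Reasoning)
open import Relation.Nullary.Decidable using (Dec; from-yes; _⊎-dec_)

open import Defs

open ≡-Reasoning

residue : (n : ℕ) .{{_ : NonZero n}} → ℤ → Fin n
residue n j = fromℕ< (n%ℕd<d j n)

residue-decomposition : ∀ n .{{_ : NonZero n}} j → j ≡ + toℕ (residue n j) + (j /ℕ n) * + n
residue-decomposition n j =
  subst (λ r → j ≡ + r + (j /ℕ n) * + n) (sym (toℕ-fromℕ< (n%ℕd<d j n))) (a≡a%ℕn+[a/ℕn]*n j n)

no-wraparound : ∀ {n r r'} k → r' ℕ.< n → + r' ≢ + r + + n * + suc k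
no-wraparound {n} {r} {r'} k r'<n e = ℕ.<⇒≱ r'<n (subst (n ℕ.≤_) (sym r'≡) n≤)
  where
  r'≡ : r' ≡ r ℕ.+ n ℕ.* suc k
  r'≡ = +-injective (trans e (cong (λ t → + r + t) (sym (pos-* n (suc k)))))
  n≤ : n ℕ.≤ r ℕ.+ n ℕ.* suc k
  n≤ = ℕ.≤-trans (ℕ.m≤m*n n (suc k)) (ℕ.m≤n+m (n ℕ.* suc k) r)

remainder-rigid : ∀ {n r r'} d → r ℕ.< n → r' ℕ.< n → + r' ≡ + r + + n * d → r ≡ r'
remainder-rigid {n} {r} (+ 0) _ _ e =
  sym (+-injective (trans e (trans (cong (λ t → + r + t) (*-zeroʳ (+ n))) (+-identityʳ (+ r)))))
remainder-rigid +[1+ k ] _ r'<n e = ⊥-elim (no-wraparound k r'<n e)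
remainder-rigid {n} {r} {r'} -[1+ k ] r<n _ e =
  ⊥-elim (no-wraparound {n} {r'} k r<n (flip (+ r') (+ r) (+ n) (+ suc k) e))
  where
  flip : ∀ a b c m → a ≡ b + c * - m → b ≡ a + c * m
  flip _ b c m refl = solve (b ∷ c ∷ m ∷ [])

residue-unique : ∀ n .{{_ : NonZero n}} {j} r q → j ≡ + toℕ r + q * + n → residue n j ≡ r
residue-unique n {j} r q j≡ = toℕ-injective
  (remainder-rigid (j /ℕ n - q) (toℕ<n (residue n j)) (toℕ<n r)
    (same-value (+ toℕ (residue n j)) (+ toℕ r) (j /ℕ n) q (+ n)
      (trans (sym (residue-decomposition n j)) j≡)))
  where
  same-value : ∀ a b c d m → a + c * m ≡ b + d * m → b ≡ a + m * (c - d)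
  same-value a b c d m e = begin
    b                    ≡⟨ solve (b ∷ d ∷ m ∷ []) ⟩
    b + d * m - d * m    ≡⟨ cong (_- d * m) (sym e) ⟩
    a + c * m - d * m    ≡⟨ solve (a ∷ c ∷ d ∷ m ∷ []) ⟩
    a + m * (c - d)      ∎

residue-+ : ∀ n .{{_ : NonZero n}} j d r → + toℕ r ≡ + toℕ (residue n j) + d → residue n (j + d) ≡ r
residue-+ n j d r r≡ = residue-unique n r (j /ℕ n)
  (shifted j (+ toℕ (residue n j)) (+ toℕ r) (j /ℕ n) (+ n) (residue-decomposition n j) r≡)
  where
  shifted : ∀ j a b q m → j ≡ a + q * m → b ≡ a + d → j + d ≡ b + q * m
  shifted _ a _ q m refl refl = solve (a ∷ q ∷ d ∷ m ∷ [])

infixl 6 _+ᵥ_ _-ᵥ_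

origin : V
origin = (+ 0 , + 0)

_+ᵥ_ _-ᵥ_ : V → V → V
p +ᵥ q = (proj₁ p + proj₁ q , proj₂ p + proj₂ q)
p -ᵥ q = (proj₁ p - proj₁ q , proj₂ p - proj₂ q)

p+ᵥorigin≡p : ∀ p → p +ᵥ origin ≡ p
p+ᵥorigin≡p p = cong₂ _,_ (+-identityʳ (proj₁ p)) (+-identityʳ (proj₂ p))

p+ᵥd-ᵥd≡p : ∀ p d → p +ᵥ d -ᵥ d ≡ p
p+ᵥd-ᵥd≡p (p₁ , p₂) (d₁ , d₂) = cong₂ _,_ (cancel p₁ d₁) (cancel p₂ d₂)
  where
  cancel : ∀ a b → a + b - b ≡ a
  cancel a b = solve (a ∷ b ∷ [])

p-ᵥd+ᵥd≡p : ∀ p d → p -ᵥ d +ᵥ d ≡ p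
p-ᵥd+ᵥd≡p (p₁ , p₂) (d₁ , d₂) = cong₂ _,_ (cancel p₁ d₁) (cancel p₂ d₂)
  where
  cancel : ∀ a b → a - b + b ≡ a
  cancel a b = solve (a ∷ b ∷ [])

p-ᵥx-ᵥd≡p-ᵥ[x+ᵥd] : ∀ p x d → p -ᵥ x -ᵥ d ≡ p -ᵥ (x +ᵥ d)
p-ᵥx-ᵥd≡p-ᵥ[x+ᵥd] (p₁ , p₂) (x₁ , x₂) (d₁ , d₂) = cong₂ _,_ (assoc p₁ x₁ d₁) (assoc p₂ x₂ d₂)
  where
  assoc : ∀ a b c → a - b - c ≡ a - (b + c)
  assoc a b c = solve (a ∷ b ∷ c ∷ [])

Local : (V → V) → Set
Local f = ∀ p → f p ≡ p ⊎ Adj p (f p)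

Adj-sym : ∀ p q → Adj p q → Adj q p
Adj-sym (p₁ , p₂) (q₁ , q₂) a = trans (cong₂ ℕ._⊔_ (∣i-j∣≡∣j-i∣ q₁ p₁) (∣i-j∣≡∣j-i∣ q₂ p₂)) a

Adj-+ᵥ : ∀ p d → Adj origin d → Adj p (p +ᵥ d)
Adj-+ᵥ (p₁ , p₂) (d₁ , d₂) a =
  trans (cong₂ ℕ._⊔_ (cong ℤ.∣_∣ (recentre p₁ d₁)) (cong ℤ.∣_∣ (recentre p₂ d₂))) a
  where
  recentre : ∀ i d → i - (i + d) ≡ + 0 - d
  recentre i d = solve (i ∷ d ∷ [])

Local-inverse : (π : V ↔ V) → Local (Inverse.to π) → Local (Inverse.from π)
Local-inverse π is-local q = Sum.map fixed adjacent (is-local (from q))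
  where
  open Inverse π
  fixed : to (from q) ≡ from q → from q ≡ q
  fixed e = trans (sym e) (strictlyInverseˡ q)
  adjacent : Adj (from q) (to (from q)) → Adj q (from q)
  adjacent a = subst (λ r → Adj r (from q)) (strictlyInverseˡ q) (Adj-sym (from q) (to (from q)) a)

permutation-move : ∀ {S T : VSet} (π : V ↔ V) → Local (Inverse.to π) →
                   (∀ p → S p ⇔ T (Inverse.to π p)) → Move S T
permutation-move {S} {T} π is-local S⇔T = record
  { move      = λ g → to (proj₁ g)
  ; local     = λ g → is-local (proj₁ g)
  ; injective = λ g h e →
      trans (sym (strictlyInverseʳ (proj₁ g))) (trans (cong from e) (strictlyInverseʳ (proj₁ h)))
  ; onto      = λ q → mk⇔
      (λ Tq → (from q , Equivalence.from (S⇔T (from q)) (subst T (sym (strictlyInverseˡ q)) Tq)) ,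
              strictlyInverseˡ q)
      (λ { ((p , Sp) , refl) → Equivalence.to (S⇔T p) Sp })
  }
  where open Inverse π

permutation-moves : ∀ {S T : VSet} (π : V ↔ V) → Local (Inverse.to π) →
                    (∀ p → S p ⇔ T (Inverse.to π p)) → Move S T × Move T S
permutation-moves {S} {T} π is-local S⇔T =
  permutation-move π is-local S⇔T ,
  permutation-move (↔-sym π) (Local-inverse π is-local)
    (λ q → ⇔.sym (subst (λ r → S (from q) ⇔ T r) (strictlyInverseˡ q) (S⇔T (from q))))
  where open Inverse π

skew : ℤ → V → ℤ
skew m w = proj₁ w - m * proj₂ w

SkewLattice : ℤ → V → Set
SkewLattice m w = ∃[ k ] skew m w ≡ + 7 * k

skew-transfer : ∀ m m' w w' c → skew m' w' ≡ skew m w + + 7 * c → SkewLattice m w ⇔ SkewLattice m' w'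
skew-transfer m m' w w' c e = mk⇔
  (λ (k , s≡) → k + c , trans e (add-multiple (skew m w) k s≡))
  (λ (k , s≡) → k - c , remove-multiple (skew m w) k (trans (sym e) s≡))
  where
  add-multiple : ∀ a k → a ≡ + 7 * k → a + + 7 * c ≡ + 7 * (k + c)
  add-multiple _ k refl = solve (k ∷ c ∷ [])
  remove-multiple : ∀ a k → a + + 7 * c ≡ + 7 * k → a ≡ + 7 * (k - c)
  remove-multiple a k e = begin
    a                      ≡⟨ solve (a ∷ c ∷ []) ⟩
    a + + 7 * c - + 7 * c  ≡⟨ cong (_- + 7 * c) e ⟩
    + 7 * k - + 7 * c      ≡⟨ solve (k ∷ c ∷ []) ⟩
    + 7 * (k - c)          ∎

skew-+ᵥ : ∀ m m' w d → skew m' (w +ᵥ d) ≡ skew m w + ((m - m') * proj₂ w + skew m' d)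
skew-+ᵥ m m' (w₁ , w₂) (d₁ , d₂) = begin
  w₁ + d₁ - m' * (w₂ + d₂)                          ≡⟨ solve (m ∷ m' ∷ w₁ ∷ w₂ ∷ d₁ ∷ d₂ ∷ []) ⟩
  w₁ - m * w₂ + ((m - m') * w₂ + (d₁ - m' * d₂))    ∎

skew--ᵥ : ∀ m w d → skew m (w -ᵥ d) ≡ skew m w - skew m d
skew--ᵥ m (w₁ , w₂) (d₁ , d₂) = begin
  w₁ - d₁ - m * (w₂ - d₂)           ≡⟨ solve (m ∷ w₁ ∷ w₂ ∷ d₁ ∷ d₂ ∷ []) ⟩
  w₁ - m * w₂ - (d₁ - m * d₂)       ∎

SkewLattice-rebase : ∀ m x ℓ p → SkewLattice m ℓ → SkewLattice m (p -ᵥ x) ⇔ SkewLattice m (p -ᵥ (x +ᵥ ℓ))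
SkewLattice-rebase m x ℓ p (k , ℓ≡) = skew-transfer m m (p -ᵥ x) (p -ᵥ (x +ᵥ ℓ)) (- k) (begin
  skew m (p -ᵥ (x +ᵥ ℓ))       ≡⟨ cong (skew m) (sym (p-ᵥx-ᵥd≡p-ᵥ[x+ᵥd] p x ℓ)) ⟩
  skew m (p -ᵥ x -ᵥ ℓ)         ≡⟨ skew--ᵥ m (p -ᵥ x) ℓ ⟩
  skew m (p -ᵥ x) - skew m ℓ   ≡⟨ cong (λ t → skew m (p -ᵥ x) - t) ℓ≡ ⟩
  skew m (p -ᵥ x) - + 7 * k    ≡⟨ cong (λ t → skew m (p -ᵥ x) + t) (neg-distribʳ-* (+ 7) k) ⟩
  skew m (p -ᵥ x) + + 7 * - k  ∎)

skew-split : ∀ m m' u e → u * (m' - m) ≡ + 1 + + 7 * e →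
             ∀ w → ∃[ ℓ ] SkewLattice m ℓ × SkewLattice m' (w -ᵥ ℓ)
skew-split m m' u e inverse (w₁ , w₂) = (m * t , t) , (+ 0 , ℓ∈) , (- (e * r) , w-ℓ∈)
  where
  r t : ℤ
  r = w₁ - m' * w₂
  t = u * - r
  ℓ∈ : m * t - m * t ≡ + 7 * + 0
  ℓ∈ = +-inverseʳ (m * t)
  w-ℓ∈ : w₁ - m * t - m' * (w₂ - t) ≡ + 7 * - (e * r)
  w-ℓ∈ = begin
    w₁ - m * (u * - (w₁ - m' * w₂)) - m' * (w₂ - u * - (w₁ - m' * w₂))
        ≡⟨ solve (m ∷ m' ∷ u ∷ w₁ ∷ w₂ ∷ []) ⟩
    (w₁ - m' * w₂) * (+ 1 - u * (m' - m))          ≡⟨ cong (λ a → r * (+ 1 - a)) inverse ⟩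
    (w₁ - m' * w₂) * (+ 1 - (+ 1 + + 7 * e))       ≡⟨ solve (m' ∷ e ∷ w₁ ∷ w₂ ∷ []) ⟩
    + 7 * - (e * (w₁ - m' * w₂))                   ∎

D-coset : ∀ x p → D x p ⇔ SkewLattice (+ 2) (p -ᵥ x)
D-coset (x₁ , x₂) (p₁ , p₂) = mk⇔
  (λ { (a , b , refl , refl) → - b , member-skew a b })
  (λ { (k , e) → p₂ - x₂ + + 3 * k , - k , first-coordinate k e , solve (p₂ ∷ x₂ ∷ k ∷ []) })
  where
  member-skew : ∀ a b → x₁ + (a * + 2 + b * - + 1) - x₁ - + 2 * (x₂ + (a * + 1 + b * + 3) - x₂) ≡ + 7 * - b
  member-skew a b = solve (x₁ ∷ x₂ ∷ a ∷ b ∷ [])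
  first-coordinate : ∀ k → p₁ - x₁ - + 2 * (p₂ - x₂) ≡ + 7 * k →
          p₁ ≡ x₁ + ((p₂ - x₂ + + 3 * k) * + 2 + - k * - + 1)
  first-coordinate k e = begin
    p₁                                              ≡⟨ solve (p₁ ∷ p₂ ∷ x₁ ∷ x₂ ∷ []) ⟩
    x₁ + (+ 2 * (p₂ - x₂) + (p₁ - x₁ - + 2 * (p₂ - x₂)))
                                                    ≡⟨ cong (λ t → x₁ + (+ 2 * (p₂ - x₂) + t)) e ⟩
    x₁ + (+ 2 * (p₂ - x₂) + + 7 * k)                ≡⟨ solve (p₂ ∷ x₁ ∷ x₂ ∷ k ∷ []) ⟩
    x₁ + ((p₂ - x₂ + + 3 * k) * + 2 + - k * - + 1)  ∎

D'-coset : ∀ x p → D' x p ⇔ SkewLattice (- + 2) (p -ᵥ x)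
D'-coset (x₁ , x₂) (p₁ , p₂) = mk⇔
  (λ { (a , b , refl , refl) → a , member-skew a b })
  (λ { (k , e) → k , + 3 * k - (p₂ - x₂) , first-coordinate k e , solve (p₂ ∷ x₂ ∷ k ∷ []) })
  where
  member-skew : ∀ a b → x₁ + (a * + 1 + b * + 2) - x₁ - - + 2 * (x₂ + (a * + 3 + b * - + 1) - x₂) ≡ + 7 * a
  member-skew a b = solve (x₁ ∷ x₂ ∷ a ∷ b ∷ [])
  first-coordinate : ∀ k → p₁ - x₁ - - + 2 * (p₂ - x₂) ≡ + 7 * k →
          p₁ ≡ x₁ + (k * + 1 + (+ 3 * k - (p₂ - x₂)) * + 2)
  first-coordinate k e = begin
    p₁                                              ≡⟨ solve (p₁ ∷ p₂ ∷ x₁ ∷ x₂ ∷ []) ⟩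
    x₁ + (- + 2 * (p₂ - x₂) + (p₁ - x₁ - - + 2 * (p₂ - x₂)))
                                                    ≡⟨ cong (λ t → x₁ + (- + 2 * (p₂ - x₂) + t)) e ⟩
    x₁ + (- + 2 * (p₂ - x₂) + + 7 * k)              ≡⟨ solve (p₂ ∷ x₁ ∷ x₂ ∷ k ∷ []) ⟩
    x₁ + (k * + 1 + (+ 3 * k - (p₂ - x₂)) * + 2)    ∎

shift : Fin 7 → V
shift 0F = (+ 0 , + 0)
shift 1F = (+ 1 , + 1)
shift 2F = (+ 1 , - + 1)
shift 3F = (+ 0 , + 1)
shift 4F = (+ 0 , - + 1)
shift 5F = (- + 1 , + 1)
shift 6F = (- + 1 , - + 1)

shiftedRow : Fin 7 → Fin 7
shiftedRow 0F = 0F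
shiftedRow 1F = 2F
shiftedRow 2F = 1F
shiftedRow 3F = 4F
shiftedRow 4F = 3F
shiftedRow 5F = 6F
shiftedRow 6F = 5F

shiftedRow-involutive : ∀ s → shiftedRow (shiftedRow s) ≡ s
shiftedRow-involutive = from-yes (all? λ s → shiftedRow (shiftedRow s) Fin.≟ s)

shiftedRow-toℕ : ∀ s → + toℕ (shiftedRow s) ≡ + toℕ s + proj₂ (shift s)
shiftedRow-toℕ = from-yes (all? λ s → + toℕ (shiftedRow s) ℤ.≟ + toℕ s + proj₂ (shift s))

shift-skew : ∀ s → skew (- + 2) (shift s) + + 4 * + toℕ s ≡ + 7 * + ⌈ toℕ s /2⌉
shift-skew = from-yes (all? λ s → skew (- + 2) (shift s) + + 4 * + toℕ s ℤ.≟ + 7 * + ⌈ toℕ s /2⌉)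

shift-king : ∀ s → shift s ≡ origin ⊎ Adj origin (shift s)
shift-king = from-yes (all? λ s → shift s ≟ᵥ origin ⊎-dec Adj? origin (shift s))
  where
  _≟ᵥ_ : (p q : V) → Dec (p ≡ q)
  _≟ᵥ_ = ≡-dec ℤ._≟_ ℤ._≟_
  Adj? : ∀ p q → Dec (Adj p q)
  Adj? (p₁ , p₂) (q₁ , q₂) = (ℤ.∣ p₁ - q₁ ∣ ℕ.⊔ ℤ.∣ p₂ - q₂ ∣) ℕ.≟ 1

rowClass : V → V → Fin 7
rowClass c p = residue 7 (proj₂ p - proj₂ c)

step unstep : V → V → V
step c p = p +ᵥ shift (rowClass c p)
unstep c q = q -ᵥ shift (shiftedRow (rowClass c q))

rowClass-+ᵥ : ∀ c p d {s} → + toℕ s ≡ + toℕ (rowClass c p) + proj₂ d → rowClass c (p +ᵥ d) ≡ s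
rowClass-+ᵥ c p d {s} s≡ =
  trans (cong (residue 7) (swap (proj₂ p) (proj₂ d) (proj₂ c))) (residue-+ 7 (proj₂ p - proj₂ c) (proj₂ d) s s≡)
  where
  swap : ∀ a b c → a + b - c ≡ a - c + b
  swap a b c = solve (a ∷ b ∷ c ∷ [])

rowClass-step : ∀ c p → rowClass c (step c p) ≡ shiftedRow (rowClass c p)
rowClass-step c p = rowClass-+ᵥ c p (shift (rowClass c p)) (shiftedRow-toℕ (rowClass c p))

rowClass-unstep : ∀ c q → rowClass c (unstep c q) ≡ shiftedRow (rowClass c q)
rowClass-unstep c q = rowClass-+ᵥ c q (- proj₁ (shift s') , - proj₂ (shift s'))
  (isolate (+ toℕ s') (proj₂ (shift s')) (begin
    + toℕ s                   ≡⟨ cong (λ r → + toℕ r) (sym (shiftedRow-involutive s)) ⟩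
    + toℕ (shiftedRow s')     ≡⟨ shiftedRow-toℕ s' ⟩
    + toℕ s' + proj₂ (shift s') ∎))
  where
  s s' : Fin 7
  s = rowClass c q
  s' = shiftedRow s
  isolate : ∀ a d {b} → b ≡ a + d → a ≡ b - d
  isolate a d refl = solve (a ∷ d ∷ [])

unstep-step : ∀ c p → unstep c (step c p) ≡ p
unstep-step c p = begin
  step c p -ᵥ shift (shiftedRow (rowClass c (step c p)))
      ≡⟨ cong (λ r → step c p -ᵥ shift (shiftedRow r)) (rowClass-step c p) ⟩
  p +ᵥ shift s -ᵥ shift (shiftedRow (shiftedRow s))
      ≡⟨ cong (λ r → p +ᵥ shift s -ᵥ shift r) (shiftedRow-involutive s) ⟩
  p +ᵥ shift s -ᵥ shift s
      ≡⟨ p+ᵥd-ᵥd≡p p (shift s) ⟩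
  p ∎
  where
  s : Fin 7
  s = rowClass c p

step-unstep : ∀ c q → step c (unstep c q) ≡ q
step-unstep c q = begin
  unstep c q +ᵥ shift (rowClass c (unstep c q))
      ≡⟨ cong (λ r → unstep c q +ᵥ shift r) (rowClass-unstep c q) ⟩
  q -ᵥ shift (shiftedRow (rowClass c q)) +ᵥ shift (shiftedRow (rowClass c q))
      ≡⟨ p-ᵥd+ᵥd≡p q (shift (shiftedRow (rowClass c q))) ⟩
  q ∎

kingStep : V → V ↔ V
kingStep c = mk↔ₛ′ (step c) (unstep c) (step-unstep c) (unstep-step c)

step-local : ∀ c → Local (step c)
step-local c p with shift-king (rowClass c p)
... | inj₁ no-shift = inj₁ (trans (cong (p +ᵥ_) no-shift) (p+ᵥorigin≡p p))
... | inj₂ adjacent = inj₂ (Adj-+ᵥ p (shift (rowClass c p)) adjacent)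

step-skew : ∀ c p → SkewLattice (+ 2) (p -ᵥ c) ⇔ SkewLattice (- + 2) (step c p -ᵥ c)
step-skew c p = skew-transfer (+ 2) (- + 2) (p -ᵥ c) (step c p -ᵥ c) (+ ⌈ toℕ s /2⌉ + + 4 * q) (begin
  skew (- + 2) (step c p -ᵥ c)                   ≡⟨ cong (skew (- + 2)) (relative p c (shift s)) ⟩
  skew (- + 2) (w +ᵥ shift s)                    ≡⟨ skew-+ᵥ (+ 2) (- + 2) w (shift s) ⟩
  skew (+ 2) w + (+ 4 * proj₂ w + skew (- + 2) (shift s))
      ≡⟨ cong (λ t → skew (+ 2) w + t) (row-multiple (proj₂ w) (+ toℕ s) q _ _
             (residue-decomposition 7 (proj₂ w)) (shift-skew s)) ⟩
  skew (+ 2) w + + 7 * (+ ⌈ toℕ s /2⌉ + + 4 * q) ∎)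
  where
  w : V
  w = p -ᵥ c
  s : Fin 7
  s = rowClass c p
  q : ℤ
  q = proj₂ w /ℕ 7
  relative : ∀ p c d → p +ᵥ d -ᵥ c ≡ p -ᵥ c +ᵥ d
  relative (p₁ , p₂) (c₁ , c₂) (d₁ , d₂) = cong₂ _,_ (swap p₁ d₁ c₁) (swap p₂ d₂ c₂)
    where
    swap : ∀ a b c → a + b - c ≡ a - c + b
    swap a b c = solve (a ∷ b ∷ c ∷ [])
  row-multiple : ∀ j r q e k → j ≡ r + q * + 7 → e + + 4 * r ≡ + 7 * k → + 4 * j + e ≡ + 7 * (k + + 4 * q)
  row-multiple _ r q e k refl e≡ = begin
    + 4 * (r + q * + 7) + e      ≡⟨ solve (r ∷ q ∷ e ∷ []) ⟩
    e + + 4 * r + + 7 * (+ 4 * q) ≡⟨ cong (_+ + 7 * (+ 4 * q)) e≡ ⟩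
    + 7 * k + + 7 * (+ 4 * q)    ≡⟨ solve (k ∷ q ∷ []) ⟩
    + 7 * (k + + 4 * q)          ∎

king-moves : ∀ y {S T : VSet} → (∀ p → S p ⇔ SkewLattice (+ 2) (p -ᵥ y)) →
             (∀ q → T q ⇔ SkewLattice (- + 2) (q -ᵥ y)) → Move S T × Move T S
king-moves y S⇔ T⇔ = permutation-moves (kingStep y) (step-local y)
  (λ p → ⇔.trans (S⇔ p) (⇔.trans (step-skew y p) (⇔.sym (T⇔ (step y p)))))

theorem1 : (∀ (x v : V) → ∃[ y ] (Move (D x) (D' y) × D' y v))
    × (∀ (x v : V) → ∃[ y ] (Move (D' x) (D y) × D y v))
theorem1 = D-to-D' , D'-to-D
  where
  D-to-D' : ∀ x v → ∃[ y ] (Move (D x) (D' y) × D' y v)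
  D-to-D' x v with skew-split (+ 2) (- + 2) (+ 5) (- + 3) refl (v -ᵥ x)
  ... | ℓ , ℓ∈L , v-y∈L' =
    y ,
    proj₁ (king-moves y (λ p → ⇔.trans (D-coset x p) (SkewLattice-rebase (+ 2) x ℓ p ℓ∈L)) (D'-coset y)) ,
    Equivalence.from (D'-coset y v) (subst (SkewLattice (- + 2)) (p-ᵥx-ᵥd≡p-ᵥ[x+ᵥd] v x ℓ) v-y∈L')
    where
    y : V
    y = x +ᵥ ℓ
  D'-to-D : ∀ x v → ∃[ y ] (Move (D' x) (D y) × D y v)
  D'-to-D x v with skew-split (- + 2) (+ 2) (+ 2) (+ 1) refl (v -ᵥ x)
  ... | ℓ , ℓ∈L' , v-y∈L =
    y ,
    proj₂ (king-moves y (D-coset y) (λ q → ⇔.trans (D'-coset x q) (SkewLattice-rebase (- + 2) x ℓ q ℓ∈L'))) ,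
    Equivalence.from (D-coset y v) (subst (SkewLattice (+ 2)) (p-ᵥx-ᵥd≡p-ᵥ[x+ᵥd] v x ℓ) v-y∈L)
    where
    y : V
    y = x +ᵥ ℓ
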